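{- For every integer $n\ge1$, \[ -\omega(n)=\sum_{\substack{m+k=n\\ m\ge 1,\ k\ge 0}}p_\psi(m)\sum_{j\ge0}\omega(k-jm), \] where $p_\psi(m)$ is the number of relatively prime partitions of $m$, i.e. partitions of $m$ whose parts have greatest common divisor $1$.
   Context: For integers $m$, $\omega(m)=1$ if $m=0$; $\omega(m)=(-1)^i$ if $m=\frac{3i^2\pm i}{2}$ for some positive integer $i$; $\omega(m)=0$ otherwise (in particular for $m<0$). -}

module Defs where

open import Data.Nat as ℕ using (ℕ; zero; suc; _≤?_; _≟_; _+_; _∸_)
open import Data.Nat.GCD using (gcd)
open import Data.Integer as ℤ using (ℤ; +_; -[1+_])
open import Data.List using (List; []; _∷_; _++_; concatMap; map; length; filter; foldr; upTo; sum)
open import Data.Bool using (Bool; true; false; _∨_; if_then_else_)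
open import Relation.Nullary.Decidable using (⌊_⌋)

-- Pentagonal-number coefficient ω : ℤ → ℤ
-- ω(0) = 1, ω(m) = (-1)^i if m = (3i²±i)/2 for some i ≥ 1, else 0
-- (in particular ω(m) = 0 for m < 0).

isPent : ℕ → ℕ → Bool
isPent m i = ⌊ 2 ℕ.* m ≟ 3 ℕ.* i ℕ.* i ℕ.+ i ⌋ ∨ ⌊ 2 ℕ.* m ≟ 3 ℕ.* i ℕ.* i ℕ.∸ i ⌋

sign : ℕ → ℤ
sign i = if ⌊ i ℕ.% 2 ≟ 0 ⌋ then + 1 else ℤ.- (+ 1)

-- search i = 1 .. m (any i with (3i²±i)/2 = m ≥ 1 satisfies i ≤ m);
-- the index i is unique for m ≥ 1.
searchPent : ℕ → ℕ → ℤ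
searchPent m zero = + 0
searchPent m (suc i) = if isPent m (suc i) then sign (suc i) else searchPent m i

ωℕ : ℕ → ℤ
ωℕ zero = + 1
ωℕ (suc m) = searchPent (suc m) (suc m)

ω : ℤ → ℤ
ω (+ m) = ωℕ m
ω -[1+ m ] = + 0

-- partsF fuel b m : all partitions of m with all parts ≤ b, listed as
-- non-increasing lists of positive parts; fuel ≥ m + b suffices
-- (each recursive call decreases m + b).
partsF : ℕ → ℕ → ℕ → List (List ℕ)
partsF fuel b zero = [] ∷ []
partsF fuel zero (suc m) = []
partsF zero (suc b) (suc m) = []
partsF (suc fuel) (suc b) (suc m) =
  -- either every part is ≤ b, or the largest part is b+1
  partsF fuel b (suc m) ++
  (if ⌊ suc b ≤? suc m ⌋
     then map (suc b ∷_) (partsF fuel (suc b) (m ∸ b))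
     else [])

partitionsB : ℕ → ℕ → List (List ℕ)
partitionsB b m = partsF (b + m) b m

partitions : ℕ → List (List ℕ)
partitions m = partitionsB m m

gcdList : List ℕ → ℕ
gcdList = foldr gcd 0

pψ : ℕ → ℕ
pψ m = length (filter (λ p → gcdList p ≟ 1) (partitions m))

Σ< : ℕ → (ℕ → ℤ) → ℤ
Σ< zero f = + 0
Σ< (suc n) f = Σ< n f ℤ.+ f n

-- inner sum  Σ_{j ≥ 0} ω(k - j m); for m ≥ 1 all terms with j > k vanish
-- (k - j m < 0), so the sum over j = 0 .. k is the full sum.
innerSum : ℕ → ℕ → ℤ
innerSum m k = Σ< (suc k) (λ j → ω (+ k ℤ.- + (j ℕ.* m)))

-- right-hand side: Σ over m + k = n, m ≥ 1, k ≥ 0, i.e. m = 1..n, k = n - m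
rhs : ℕ → ℤ
rhs n = Σ< n (λ i → + pψ (suc i) ℤ.* innerSum (suc i) (n ℕ.∸ suc i))

{-# OPTIONS --safe #-}
-- Shanks' telescoping identity gives Euler's pentagonal theorem in finite form: for m ≤ n the
-- coefficient of q^m in ∏_{i≤n} (1 − q^i) is ω(m). Multiplying by the partition generating function,
-- Σ_{N≤n} ω(n − N) p(N) = 0 for n ≥ 1, i.e. −ω(n) = Σ_{1≤N≤n} ω(n − N) p(N). Grouping the partitions
-- of N by the gcd d of their parts and dividing the parts by d gives p(N) = Σ_{d ∣ N} p_ψ(N/d).
-- Substituting N = d m and summing over m first yields Σ_m p_ψ(m) Σ_{d≥1} ω(n − d m), which is the
-- right-hand side with d = j + 1.
module Submission where

open import Defs
open import Data.Nat using (ℕ; _≥_)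
open import Data.Integer using (+_; -_)
open import Relation.Binary.PropositionalEquality using (_≡_)

open import Data.Nat as ℕ using (zero; suc; _≤_; _<_; _≤′_; ≤′-refl; ≤′-step; z≤n; s≤s; _≤?_; _≟_)
import Data.Nat.Properties as ℕP
open import Data.Integer using (ℤ; _+_; _*_; _-_)
import Data.Integer.Properties as ℤP
open import Data.Integer.Tactic.RingSolver using (solve-∀)
open import Data.Nat.Tactic.RingSolver using () renaming (solve-∀ to solveℕ-∀)
open import Relation.Binary.PropositionalEquality
  using (_≢_; refl; sym; trans; cong; cong₂; subst; subst₂; _≗_; module ≡-Reasoning)
open import Relation.Nullary using (Dec; yes; no; ¬_)
open import Data.Empty using (⊥-elim)
open import Data.List using (List; []; _∷_; _++_; map; length; filter)
import Data.List.Properties as LP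
open import Data.List.Relation.Unary.All as All using (All; []; _∷_; all?)
import Data.List.Relation.Unary.All.Properties as AllP
open import Data.Nat.ListAction using (sum)
open import Data.Nat.Divisibility using (_∣_; divides; _∣?_; ∣-trans; ∣m∣n⇒∣m+n; ∣m+n∣m⇒∣n; ∣⇒≤; 0∣⇒≡0; m∣m*n)
open import Data.Nat.GCD using (gcd; gcd[m,n]∣m; gcd[m,n]∣n; c*gcd[m,n]≡gcd[cm,cn])
open import Data.Product using (_×_; _,_)
open import Relation.Unary using (Pred; Decidable)
open import Level using (0ℓ)
open import Algebra.Bundles using (AbelianGroup)
open import Algebra.Properties.Group (AbelianGroup.group ℤP.+-0-abelianGroup) using (inverseʳ-unique)
open import Data.Sum using (_⊎_; inj₁; inj₂)
open import Data.Bool using (true; false; _∨_; if_then_else_)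
open import Data.Bool.Properties using (∨-zeroʳ)
open import Data.Nat.DivMod using (_%_; [m+n]%n≡m%n)
open import Relation.Nullary.Decidable using (⌊_⌋; _⊎-dec_; isYes≗does; dec-true; dec-false)
open import Function using (_∘_)

Σ<-cong : ∀ n {f g : ℕ → ℤ} → (∀ i → i < n → f i ≡ g i) → Σ< n f ≡ Σ< n g
Σ<-cong zero eq = refl
Σ<-cong (suc n) eq = cong₂ _+_ (Σ<-cong n (λ i i<n → eq i (ℕP.m<n⇒m<1+n i<n))) (eq n ℕP.≤-refl)

Σ<-zero : ∀ n {f : ℕ → ℤ} → (∀ i → i < n → f i ≡ + 0) → Σ< n f ≡ + 0
Σ<-zero zero eq = refl
Σ<-zero (suc n) eq = cong₂ _+_ (Σ<-zero n (λ i i<n → eq i (ℕP.m<n⇒m<1+n i<n))) (eq n ℕP.≤-refl)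

Σ<-distrib-+ : ∀ n (f g : ℕ → ℤ) → Σ< n (λ i → f i + g i) ≡ Σ< n f + Σ< n g
Σ<-distrib-+ zero f g = refl
Σ<-distrib-+ (suc n) f g =
  trans (cong (_+ (f n + g n)) (Σ<-distrib-+ n f g)) (interchange (Σ< n f) (Σ< n g) (f n) (g n))
  where
  interchange : ∀ a b c d → a + b + (c + d) ≡ a + c + (b + d)
  interchange = solve-∀

Σ<-neg : ∀ n (f : ℕ → ℤ) → Σ< n (λ i → - f i) ≡ - Σ< n f
Σ<-neg zero f = refl
Σ<-neg (suc n) f = trans (cong (_+ - f n) (Σ<-neg n f)) (sym (ℤP.neg-distrib-+ (Σ< n f) (f n)))

Σ<-distribˡ-* : ∀ n c (f : ℕ → ℤ) → Σ< n (λ i → c * f i) ≡ c * Σ< n f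
Σ<-distribˡ-* zero c f = sym (ℤP.*-zeroʳ c)
Σ<-distribˡ-* (suc n) c f =
  trans (cong (_+ c * f n) (Σ<-distribˡ-* n c f)) (sym (ℤP.*-distribˡ-+ c (Σ< n f) (f n)))

Σ<-+ : ∀ a k (f : ℕ → ℤ) → Σ< (a ℕ.+ k) f ≡ Σ< a f + Σ< k (λ i → f (a ℕ.+ i))
Σ<-+ a zero f rewrite ℕP.+-identityʳ a = sym (ℤP.+-identityʳ _)
Σ<-+ a (suc k) f rewrite ℕP.+-suc a k | Σ<-+ a k f = ℤP.+-assoc (Σ< a f) _ _

Σ<-suc : ∀ n (f : ℕ → ℤ) → Σ< (suc n) f ≡ f 0 + Σ< n (λ i → f (suc i))
Σ<-suc n f = trans (Σ<-+ 1 n f) (cong (_+ Σ< n (λ i → f (suc i))) (ℤP.+-identityˡ (f 0)))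

Σ<-swap : ∀ n m (f : ℕ → ℕ → ℤ) →
          Σ< n (λ i → Σ< m (λ j → f i j)) ≡ Σ< m (λ j → Σ< n (λ i → f i j))
Σ<-swap zero m f = sym (Σ<-zero m (λ _ _ → refl))
Σ<-swap (suc n) m f = trans (cong (_+ Σ< m (f n)) (Σ<-swap n m f))
                            (sym (Σ<-distrib-+ m (λ j → Σ< n (λ i → f i j)) (f n)))

Σ<-reverse : ∀ n (f : ℕ → ℤ) → Σ< (suc n) f ≡ Σ< (suc n) (λ i → f (n ℕ.∸ i))
Σ<-reverse zero f = refl
Σ<-reverse (suc n) f = begin
  Σ< (suc n) f + f (suc n)                         ≡⟨ cong (_+ f (suc n)) (Σ<-reverse n f) ⟩
  Σ< (suc n) (λ i → f (n ℕ.∸ i)) + f (suc n)       ≡⟨ ℤP.+-comm _ (f (suc n)) ⟩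
  f (suc n) + Σ< (suc n) (λ i → f (n ℕ.∸ i))       ≡⟨ Σ<-suc (suc n) (λ i → f (suc n ℕ.∸ i)) ⟨
  Σ< (suc (suc n)) (λ i → f (suc n ℕ.∸ i))         ∎
  where open ≡-Reasoning

Σ<-extend : ∀ {a b} (f : ℕ → ℤ) → a ≤ b → (∀ i → a ≤ i → i < b → f i ≡ + 0) → Σ< a f ≡ Σ< b f
Σ<-extend {a} {b} f a≤b vanish = begin
  Σ< a f                                     ≡⟨ ℤP.+-identityʳ _ ⟨
  Σ< a f + + 0                               ≡⟨ cong (λ z → Σ< a f + z) (Σ<-zero (b ℕ.∸ a) tail-vanishes) ⟨
  Σ< a f + Σ< (b ℕ.∸ a) (λ i → f (a ℕ.+ i))  ≡⟨ Σ<-+ a (b ℕ.∸ a) f ⟨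
  Σ< (a ℕ.+ (b ℕ.∸ a)) f                     ≡⟨ cong (λ c → Σ< c f) (ℕP.m+[n∸m]≡n a≤b) ⟩
  Σ< b f                                     ∎
  where
  open ≡-Reasoning
  tail-vanishes : ∀ i → i < b ℕ.∸ a → f (a ℕ.+ i) ≡ + 0
  tail-vanishes i i< = vanish (a ℕ.+ i) (ℕP.m≤m+n a i)
    (subst (a ℕ.+ i <_) (ℕP.m+[n∸m]≡n a≤b) (ℕP.+-monoʳ-< a i<))

𝟙 : ∀ {P : Set} → Dec P → ℤ
𝟙 (yes _) = + 1
𝟙 (no _)  = + 0

𝟙-cong : ∀ {P R : Set} (p : Dec P) (r : Dec R) → (P → R) → (R → P) → 𝟙 p ≡ 𝟙 r
𝟙-cong (yes _) (yes _) _ _ = refl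
𝟙-cong (yes p) (no ¬r) f _ = ⊥-elim (¬r (f p))
𝟙-cong (no ¬p) (yes r) _ g = ⊥-elim (¬p (g r))
𝟙-cong (no _)  (no _)  _ _ = refl

𝟙-≢-* : ∀ {x i} → x ≢ i → ∀ h → 𝟙 (x ≟ i) * h ≡ + 0
𝟙-≢-* {x} {i} x≢i h with x ≟ i
... | yes x≡i = ⊥-elim (x≢i x≡i)
... | no _    = refl

isYes-true : ∀ {P : Set} (d : Dec P) → P → ⌊ d ⌋ ≡ true
isYes-true d p = trans (isYes≗does d) (dec-true d p)

isYes-false : ∀ {P : Set} (d : Dec P) → ¬ P → ⌊ d ⌋ ≡ false
isYes-false d ¬p = trans (isYes≗does d) (dec-false d ¬p)

Σ<-select : ∀ n x (h : ℕ → ℤ) → (n ≤ x → h x ≡ + 0) → Σ< n (λ i → 𝟙 (x ≟ i) * h i) ≡ h x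
Σ<-select zero x h vanish = sym (vanish z≤n)
Σ<-select (suc n) x h vanish with x ≟ n
... | yes refl = trans (cong₂ _+_ (Σ<-zero n (λ i i<x → 𝟙-≢-* (ℕP.>⇒≢ i<x) (h i))) (ℤP.*-identityˡ (h x)))
                       (ℤP.+-identityˡ (h x))
... | no x≢n = trans (cong₂ _+_ (Σ<-select n x h (λ n≤x → vanish (ℕP.≤∧≢⇒< n≤x (x≢n ∘ sym))))
                                (ℤP.*-zeroˡ (h n)))
                     (ℤP.+-identityʳ (h x))

Seq : Set
Seq = ℕ → ℤ

infixl 6 _-ˢ_
infixr 8 q^_·_ [1-q^_]·_
infixl 7 _⋆_

δ : Seq
δ zero    = + 1
δ (suc _) = + 0

_-ˢ_ : Seq → Seq → Seq
(f -ˢ g) m = f m - g m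

q^_·_ : ℕ → Seq → Seq
q^ zero  · f = f
(q^ suc a · f) zero    = + 0
(q^ suc a · f) (suc m) = (q^ a · f) m

[1-q^_]·_ : ℕ → Seq → Seq
[1-q^ a ]· f = f -ˢ q^ a · f

q^-cong : ∀ a {f g} → f ≗ g → q^ a · f ≗ q^ a · g
q^-cong zero    f≗g m       = f≗g m
q^-cong (suc a) f≗g zero    = refl
q^-cong (suc a) f≗g (suc m) = q^-cong a f≗g m

q^-+ : ∀ a b f → q^ (a ℕ.+ b) · f ≗ q^ a · q^ b · f
q^-+ zero    b f m       = refl
q^-+ (suc a) b f zero    = refl
q^-+ (suc a) b f (suc m) = q^-+ a b f m

q^-comm : ∀ a b f → q^ a · q^ b · f ≗ q^ b · q^ a · f
q^-comm a b f m = begin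
  (q^ a · q^ b · f) m    ≡⟨ q^-+ a b f m ⟨
  (q^ (a ℕ.+ b) · f) m   ≡⟨ cong (λ c → (q^ c · f) m) (ℕP.+-comm a b) ⟩
  (q^ (b ℕ.+ a) · f) m   ≡⟨ q^-+ b a f m ⟩
  (q^ b · q^ a · f) m    ∎
  where open ≡-Reasoning

q^-distrib-ˢ : ∀ a f g → q^ a · (f -ˢ g) ≗ q^ a · f -ˢ q^ a · g
q^-distrib-ˢ zero    f g m       = refl
q^-distrib-ˢ (suc a) f g zero    = refl
q^-distrib-ˢ (suc a) f g (suc m) = q^-distrib-ˢ a f g m

q^-below : ∀ a f m → m < a → (q^ a · f) m ≡ + 0
q^-below (suc a) f zero    _         = refl
q^-below (suc a) f (suc m) (s≤s m<a) = q^-below a f m m<a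

q^-above : ∀ a f m → a ≤ m → (q^ a · f) m ≡ f (m ℕ.∸ a)
q^-above zero    f m       _         = refl
q^-above (suc a) f (suc m) (s≤s a≤m) = q^-above a f m a≤m

q^·δ-same : ∀ a → (q^ a · δ) a ≡ + 1
q^·δ-same zero    = refl
q^·δ-same (suc a) = q^·δ-same a

q^·δ-≢ : ∀ a m → a ≢ m → (q^ a · δ) m ≡ + 0
q^·δ-≢ zero    zero    a≢m = ⊥-elim (a≢m refl)
q^·δ-≢ zero    (suc m) a≢m = refl
q^·δ-≢ (suc a) zero    a≢m = refl
q^·δ-≢ (suc a) (suc m) a≢m = q^·δ-≢ a m (a≢m ∘ cong suc)

[1-q^]-cong : ∀ a {f g} → f ≗ g → [1-q^ a ]· f ≗ [1-q^ a ]· g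
[1-q^]-cong a f≗g m = cong₂ _-_ (f≗g m) (q^-cong a f≗g m)

[1-q^]-comm : ∀ a b f → [1-q^ a ]· [1-q^ b ]· f ≗ [1-q^ b ]· [1-q^ a ]· f
[1-q^]-comm a b f m
  rewrite q^-distrib-ˢ a f (q^ b · f) m | q^-distrib-ˢ b f (q^ a · f) m | q^-comm a b f m =
  swap (f m) ((q^ b · f) m) ((q^ a · f) m) ((q^ b · q^ a · f) m)
  where
  swap : ∀ x y z w → x - y - (z - w) ≡ x - z - (y - w)
  swap = solve-∀

-- qPoch k l = (q^{k+1}; q)_l = ∏_{k<i≤k+l} (1 − q^i), and prodFrom k n = ∏_{k<i≤n} (1 − q^i).
qPoch : ℕ → ℕ → Seq
qPoch k zero    = δ
qPoch k (suc l) = [1-q^ suc (k ℕ.+ l) ]· qPoch k l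

qPoch-peel : ∀ k l → [1-q^ suc k ]· qPoch (suc k) l ≗ qPoch k (suc l)
qPoch-peel k zero m rewrite ℕP.+-identityʳ k = refl
qPoch-peel k (suc l) m = begin
  ([1-q^ suc k ]· [1-q^ top ]· qPoch (suc k) l) m   ≡⟨ [1-q^]-comm (suc k) top (qPoch (suc k) l) m ⟩
  ([1-q^ top ]· [1-q^ suc k ]· qPoch (suc k) l) m   ≡⟨ [1-q^]-cong top (qPoch-peel k l) m ⟩
  ([1-q^ top ]· qPoch k (suc l)) m                  ≡⟨ cong (λ c → ([1-q^ suc c ]· qPoch k (suc l)) m) (ℕP.+-suc k l) ⟨
  qPoch k (suc (suc l)) m                           ∎
  where
  open ≡-Reasoning
  top = suc (suc k ℕ.+ l)

prodFrom : ℕ → ℕ → Seq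
prodFrom k n = qPoch k (n ℕ.∸ k)

prodFrom-extend : ∀ {k n} → k ≤ n → prodFrom k (suc n) ≗ [1-q^ suc n ]· prodFrom k n
prodFrom-extend {k} {n} k≤n m rewrite ℕP.+-∸-assoc 1 k≤n =
  cong (λ c → ([1-q^ suc c ]· prodFrom k n) m) (ℕP.m+[n∸m]≡n k≤n)

prodFrom-self : ∀ n → prodFrom n n ≗ δ
prodFrom-self n m rewrite ℕP.n∸n≡0 n = refl

prodFrom-peel : ∀ {j n} → j < n → [1-q^ suc j ]· prodFrom (suc j) n ≗ prodFrom j n
prodFrom-peel {j} {n} j<n m =
  trans (qPoch-peel j (n ℕ.∸ suc j) m) (cong (λ l → qPoch j l m) (sym (ℕP.+-∸-assoc 1 j<n)))

_⋆_ : Seq → Seq → Seq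
(f ⋆ g) n = Σ< (suc n) (λ i → f (n ℕ.∸ i) * g i)

⋆-comm : ∀ f g → f ⋆ g ≗ g ⋆ f
⋆-comm f g n = trans (Σ<-reverse n _) (Σ<-cong (suc n) λ i i≤n →
  trans (cong (λ j → f j * g (n ℕ.∸ i)) (ℕP.m∸[m∸n]≡n (ℕP.≤-pred i≤n))) (ℤP.*-comm (f i) (g (n ℕ.∸ i))))

⋆-congʳ : ∀ f {g h} → g ≗ h → f ⋆ g ≗ f ⋆ h
⋆-congʳ f g≗h n = Σ<-cong (suc n) (λ i _ → cong (f (n ℕ.∸ i) *_) (g≗h i))

⋆-q^ʳ : ∀ a f g → f ⋆ q^ a · g ≗ q^ a · (f ⋆ g)
⋆-q^ʳ zero    f g n       = refl
⋆-q^ʳ (suc a) f g zero    = trans (ℤP.+-identityˡ _) (ℤP.*-zeroʳ (f 0))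
⋆-q^ʳ (suc a) f g (suc n) = begin
  (f ⋆ q^ suc a · g) (suc n)                                  ≡⟨ Σ<-suc (suc n) _ ⟩
  f (suc n) * + 0 + Σ< (suc n) (λ i → f (n ℕ.∸ i) * (q^ a · g) i)
                                                              ≡⟨ cong (_+ (f ⋆ q^ a · g) n) (ℤP.*-zeroʳ (f (suc n))) ⟩
  + 0 + (f ⋆ q^ a · g) n                                      ≡⟨ ℤP.+-identityˡ _ ⟩
  (f ⋆ q^ a · g) n                                            ≡⟨ ⋆-q^ʳ a f g n ⟩
  (q^ a · (f ⋆ g)) n                                          ∎
  where open ≡-Reasoning

⋆-distribˡ-ˢ : ∀ f g h → f ⋆ (g -ˢ h) ≗ f ⋆ g -ˢ f ⋆ h
⋆-distribˡ-ˢ f g h n = begin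
  Σ< (suc n) (λ i → f (n ℕ.∸ i) * (g i - h i))                    ≡⟨ Σ<-cong (suc n) (λ i _ → expand (f (n ℕ.∸ i)) (g i) (h i)) ⟩
  Σ< (suc n) (λ i → f (n ℕ.∸ i) * g i + - (f (n ℕ.∸ i) * h i))    ≡⟨ Σ<-distrib-+ (suc n) _ _ ⟩
  (f ⋆ g) n + Σ< (suc n) (λ i → - (f (n ℕ.∸ i) * h i))            ≡⟨ cong (λ z → (f ⋆ g) n + z) (Σ<-neg (suc n) _) ⟩
  (f ⋆ g) n - (f ⋆ h) n                                           ∎
  where
  open ≡-Reasoning
  expand : ∀ x y z → x * (y - z) ≡ x * y + - (x * z)
  expand = solve-∀

⋆-[1-q^] : ∀ a f g → ([1-q^ a ]· f) ⋆ g ≗ f ⋆ [1-q^ a ]· g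
⋆-[1-q^] a f g n = begin
  (([1-q^ a ]· f) ⋆ g) n                      ≡⟨ ⋆-comm ([1-q^ a ]· f) g n ⟩
  (g ⋆ [1-q^ a ]· f) n                        ≡⟨ ⋆-distribˡ-ˢ g f (q^ a · f) n ⟩
  (g ⋆ f) n - (g ⋆ q^ a · f) n                ≡⟨ cong₂ _-_ (⋆-comm g f n) (⋆-q^ʳ a g f n) ⟩
  (f ⋆ g) n - (q^ a · (g ⋆ f)) n              ≡⟨ cong (λ z → (f ⋆ g) n - z) (q^-cong a (⋆-comm g f) n) ⟩
  (f ⋆ g) n - (q^ a · (f ⋆ g)) n              ≡⟨ cong (λ z → (f ⋆ g) n - z) (⋆-q^ʳ a f g n) ⟨
  (f ⋆ g) n - (f ⋆ q^ a · g) n                ≡⟨ ⋆-distribˡ-ˢ f g (q^ a · g) n ⟨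
  (f ⋆ [1-q^ a ]· g) n                        ∎
  where open ≡-Reasoning

δ-⋆ : ∀ g → δ ⋆ g ≗ g
δ-⋆ g n = begin
  (δ ⋆ g) n                                             ≡⟨ ⋆-comm δ g n ⟩
  (g ⋆ δ) n                                             ≡⟨ Σ<-suc n _ ⟩
  g n * + 1 + Σ< n (λ i → g (n ℕ.∸ suc i) * + 0)
    ≡⟨ cong₂ _+_ (ℤP.*-identityʳ (g n)) (Σ<-zero n (λ i _ → ℤP.*-zeroʳ (g (n ℕ.∸ suc i)))) ⟩
  g n + + 0                                             ≡⟨ ℤP.+-identityʳ (g n) ⟩
  g n                                                   ∎
  where open ≡-Reasoning

−1^_ : ℕ → ℤ
−1^ zero  = + 1
−1^ suc k = - −1^ k

tri : ℕ → ℕ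
tri zero    = 0
tri (suc j) = suc j ℕ.+ tri j

shanksTerm : ℕ → ℕ → Seq
shanksTerm n k = q^ (n ℕ.* k ℕ.+ tri k) · prodFrom k n

shanks : ℕ → Seq
shanks n m = Σ< (suc n) (λ k → −1^ k * shanksTerm n k m)

-- (3i² − i)/2 and (3i² + i)/2 for i = j + 1.
pent⁻ pent⁺ : ℕ → ℕ
pent⁻ j = suc j ℕ.* suc j ℕ.+ tri j
pent⁺ j = suc j ℕ.* suc j ℕ.+ tri (suc j)

pentTerm : ℕ → Seq
pentTerm j m = −1^ suc j * ((q^ pent⁻ j · δ) m + (q^ pent⁺ j · δ) m)

-- Each term of shanks (n + 1) splits as C k − E k and E j = B (j + 1) − C (j + 1), so the sum
-- telescopes back to shanks n, leaving only E n = q^{pent⁻ n} and the new last term q^{pent⁺ n}.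
module ShanksStep (n m : ℕ) where
  B C E : ℕ → ℤ
  B k = shanksTerm n k m
  C k = (q^ (n ℕ.* k ℕ.+ tri k) · q^ k · prodFrom k n) m
  E k = (q^ (n ℕ.* suc k ℕ.+ tri (suc k)) · prodFrom k n) m

  shanksTerm-suc : ∀ {k} → k ≤ n → shanksTerm (suc n) k m ≡ C k - E k
  shanksTerm-suc {k} k≤n = begin
    (q^ a · prodFrom k (suc n)) m                               ≡⟨ q^-cong a (prodFrom-extend k≤n) m ⟩
    (q^ a · [1-q^ suc n ]· prodFrom k n) m                      ≡⟨ q^-distrib-ˢ a _ _ m ⟩
    (q^ a · prodFrom k n) m - (q^ a · q^ suc n · prodFrom k n) m
      ≡⟨ cong₂ _-_ (trans (cong (λ c → (q^ c · prodFrom k n) m) (shift₁ n k (tri k)))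
                          (q^-+ (n ℕ.* k ℕ.+ tri k) k (prodFrom k n) m))
                   (trans (sym (q^-+ a (suc n) _ m))
                          (cong (λ c → (q^ c · prodFrom k n) m) (shift₂ n k (tri k)))) ⟩
    C k - E k                                                   ∎
    where
    open ≡-Reasoning
    a = suc n ℕ.* k ℕ.+ tri k
    shift₁ : ∀ n k t → suc n ℕ.* k ℕ.+ t ≡ n ℕ.* k ℕ.+ t ℕ.+ k
    shift₁ = solveℕ-∀
    shift₂ : ∀ n k t → suc n ℕ.* k ℕ.+ t ℕ.+ suc n ≡ n ℕ.* suc k ℕ.+ (suc k ℕ.+ t)
    shift₂ = solveℕ-∀

  C-suc : ∀ {j} → j < n → C (suc j) ≡ B (suc j) - E j
  C-suc {j} j<n = begin
    C (suc j)                                           ≡⟨ rearrange (B (suc j)) (C (suc j)) ⟩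
    B (suc j) - (B (suc j) - C (suc j))                 ≡⟨ cong (λ z → B (suc j) - z) (q^-distrib-ˢ a _ _ m) ⟨
    B (suc j) - (q^ a · [1-q^ suc j ]· prodFrom (suc j) n) m
                                                        ≡⟨ cong (λ z → B (suc j) - z) (q^-cong a (prodFrom-peel j<n) m) ⟩
    B (suc j) - E j                                     ∎
    where
    open ≡-Reasoning
    a = n ℕ.* suc j ℕ.+ tri (suc j)
    rearrange : ∀ b c → c ≡ b - (b - c)
    rearrange = solve-∀

  E-last : E n ≡ (q^ pent⁻ n · δ) m
  E-last = trans (cong (λ c → (q^ c · prodFrom n n) m) (shift n (tri n))) (q^-cong (pent⁻ n) (prodFrom-self n) m)
    where
    shift : ∀ n t → n ℕ.* suc n ℕ.+ (suc n ℕ.+ t) ≡ suc n ℕ.* suc n ℕ.+ t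
    shift = solveℕ-∀

  Σ<-C : Σ< (suc n) (λ k → −1^ k * C k) ≡ shanks n m + Σ< n (λ j → −1^ j * E j)
  Σ<-C = begin
    Σ< (suc n) (λ k → −1^ k * C k)
      ≡⟨ Σ<-suc n _ ⟩
    + 1 * B 0 + Σ< n (λ j → −1^ suc j * C (suc j))
      ≡⟨ cong (λ z → + 1 * B 0 + z) (Σ<-cong n (λ j j<n →
           trans (cong (−1^ suc j *_) (C-suc j<n)) (expand (−1^ j) (B (suc j)) (E j)))) ⟩
    + 1 * B 0 + Σ< n (λ j → −1^ suc j * B (suc j) + −1^ j * E j)
      ≡⟨ cong (λ z → + 1 * B 0 + z) (Σ<-distrib-+ n _ _) ⟩
    + 1 * B 0 + (Σ< n (λ j → −1^ suc j * B (suc j)) + Σ< n (λ j → −1^ j * E j))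
      ≡⟨ ℤP.+-assoc (+ 1 * B 0) _ _ ⟨
    + 1 * B 0 + Σ< n (λ j → −1^ suc j * B (suc j)) + Σ< n (λ j → −1^ j * E j)
      ≡⟨ cong (_+ Σ< n (λ j → −1^ j * E j)) (Σ<-suc n (λ k → −1^ k * B k)) ⟨
    shanks n m + Σ< n (λ j → −1^ j * E j)
      ∎
    where
    open ≡-Reasoning
    expand : ∀ s b e → - s * (b - e) ≡ - s * b + s * e
    expand = solve-∀

  shanks-suc : shanks (suc n) m ≡ shanks n m + pentTerm n m
  shanks-suc = begin
    shanks (suc n) m
      ≡⟨ cong₂ _+_ (Σ<-cong (suc n) (λ k k≤n → trans (cong (−1^ k *_) (shanksTerm-suc (ℕP.≤-pred k≤n)))
                                                    (ℤP.*-distribˡ-+ (−1^ k) (C k) (- E k))))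
                   (cong (−1^ suc n *_) (q^-cong (pent⁺ n) (prodFrom-self (suc n)) m)) ⟩
    Σ< (suc n) (λ k → −1^ k * C k + −1^ k * - E k) + −1^ suc n * B⁺
      ≡⟨ cong (_+ −1^ suc n * B⁺) (Σ<-distrib-+ (suc n) _ _) ⟩
    Σ< (suc n) (λ k → −1^ k * C k) + Σ< (suc n) (λ k → −1^ k * - E k) + −1^ suc n * B⁺
      ≡⟨ cong₂ (λ x y → x + y + −1^ suc n * B⁺) Σ<-C
               (trans (Σ<-cong (suc n) (λ k _ → sym (ℤP.neg-distribʳ-* (−1^ k) (E k)))) (Σ<-neg (suc n) _)) ⟩
    shanks n m + Σ< n (λ j → −1^ j * E j) + - (Σ< n (λ j → −1^ j * E j) + −1^ n * E n) + −1^ suc n * B⁺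
      ≡⟨ cancel (shanks n m) (Σ< n (λ j → −1^ j * E j)) (−1^ n) (E n) B⁺ ⟩
    shanks n m + −1^ suc n * (E n + B⁺)
      ≡⟨ cong (λ e → shanks n m + −1^ suc n * (e + B⁺)) E-last ⟩
    shanks n m + pentTerm n m
      ∎
    where
    open ≡-Reasoning
    B⁺ = (q^ pent⁺ n · δ) m
    cancel : ∀ s x g a b → s + x + - (x + g * a) + - g * b ≡ s + - g * (a + b)
    cancel = solve-∀

pentSeries : ℕ → Seq
pentSeries N m = Σ< N (λ j → pentTerm j m)

shanks≡δ+pentSeries : ∀ n m → shanks n m ≡ δ m + pentSeries n m
shanks≡δ+pentSeries zero    m = trans (ℤP.+-identityˡ _) (trans (ℤP.*-identityˡ (δ m)) (sym (ℤP.+-identityʳ (δ m))))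
shanks≡δ+pentSeries (suc n) m = begin
  shanks (suc n) m                              ≡⟨ ShanksStep.shanks-suc n m ⟩
  shanks n m + pentTerm n m                     ≡⟨ cong (_+ pentTerm n m) (shanks≡δ+pentSeries n m) ⟩
  δ m + pentSeries n m + pentTerm n m           ≡⟨ ℤP.+-assoc (δ m) (pentSeries n m) _ ⟩
  δ m + pentSeries (suc n) m                    ∎
  where open ≡-Reasoning

shanks-low : ∀ {n m} → m ≤ n → shanks n m ≡ prodFrom 0 n m
shanks-low {n} {m} m≤n = begin
  shanks n m                                                     ≡⟨ Σ<-suc n _ ⟩
  + 1 * shanksTerm n 0 m + Σ< n (λ j → −1^ suc j * shanksTerm n (suc j) m)
    ≡⟨ cong₂ _+_ (trans (ℤP.*-identityˡ _) (cong (λ c → (q^ c · prodFrom 0 n) m) (trans (ℕP.+-identityʳ _) (ℕP.*-zeroʳ n))))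
                 (Σ<-zero n (λ j _ → trans (cong (−1^ suc j *_) (q^-below _ _ m (beyond j))) (ℤP.*-zeroʳ (−1^ suc j)))) ⟩
  prodFrom 0 n m + + 0                                           ≡⟨ ℤP.+-identityʳ _ ⟩
  prodFrom 0 n m                                                 ∎
  where
  open ≡-Reasoning
  beyond : ∀ j → m < n ℕ.* suc j ℕ.+ tri (suc j)
  beyond j = ℕP.≤-<-trans (ℕP.≤-trans m≤n (ℕP.m≤m*n n (suc j))) (ℕP.m<m+n (n ℕ.* suc j) (s≤s z≤n))

tri-mono-≤ : ∀ {j k} → j ≤ k → tri j ≤ tri k
tri-mono-≤ z≤n       = z≤n
tri-mono-≤ (s≤s j≤k) = ℕP.+-mono-≤ (s≤s j≤k) (tri-mono-≤ j≤k)

pent⁻<pent⁺ : ∀ j → pent⁻ j < pent⁺ j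
pent⁻<pent⁺ j = ℕP.+-monoʳ-< (suc j ℕ.* suc j) (ℕP.m<n+m (tri j) (s≤s z≤n))

pent⁺<pent⁻ : ∀ {j k} → j < k → pent⁺ j < pent⁻ k
pent⁺<pent⁻ j<k = ℕP.+-mono-<-≤ (ℕP.*-mono-< (s≤s j<k) (s≤s j<k)) (tri-mono-≤ j<k)

<pent⁻ : ∀ j → j < pent⁻ j
<pent⁻ j = ℕP.≤-trans (ℕP.m≤m*n (suc j) (suc j)) (ℕP.m≤m+n _ (tri j))

pentTerm-miss : ∀ j {m} → pent⁻ j ≢ m → pent⁺ j ≢ m → pentTerm j m ≡ + 0
pentTerm-miss j {m} ≢⁻ ≢⁺ =
  trans (cong₂ (λ x y → −1^ suc j * (x + y)) (q^·δ-≢ (pent⁻ j) m ≢⁻) (q^·δ-≢ (pent⁺ j) m ≢⁺))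
        (ℤP.*-zeroʳ (−1^ suc j))

pentTerm-hit : ∀ j {m} → pent⁻ j ≡ m ⊎ pent⁺ j ≡ m → pentTerm j m ≡ −1^ suc j
pentTerm-hit j (inj₁ refl) =
  trans (cong₂ (λ x y → −1^ suc j * (x + y)) (q^·δ-same (pent⁻ j)) (q^·δ-≢ (pent⁺ j) _ (ℕP.>⇒≢ (pent⁻<pent⁺ j))))
        (ℤP.*-identityʳ (−1^ suc j))
pentTerm-hit j (inj₂ refl) =
  trans (cong₂ (λ x y → −1^ suc j * (x + y)) (q^·δ-≢ (pent⁻ j) _ (ℕP.<⇒≢ (pent⁻<pent⁺ j))) (q^·δ-same (pent⁺ j)))
        (ℤP.*-identityʳ (−1^ suc j))

pentSeries-before : ∀ j {m} → pent⁻ j ≤ m → pentSeries j m ≡ + 0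
pentSeries-before j {m} pent⁻j≤m = Σ<-zero j λ i i<j →
  let pent⁺i<m = ℕP.<-≤-trans (pent⁺<pent⁻ i<j) pent⁻j≤m in
  pentTerm-miss i (ℕP.<⇒≢ (ℕP.<-trans (pent⁻<pent⁺ i) pent⁺i<m)) (ℕP.<⇒≢ pent⁺i<m)

pentSeries-stable : ∀ {n m} → m ≤ n → pentSeries n m ≡ pentSeries m m
pentSeries-stable m≤n = sym (Σ<-extend _ m≤n λ i m≤i _ →
  let m<pent⁻i = ℕP.≤-<-trans m≤i (<pent⁻ i) in
  pentTerm-miss i (ℕP.>⇒≢ m<pent⁻i) (ℕP.>⇒≢ (ℕP.<-trans m<pent⁻i (pent⁻<pent⁺ i))))

twice-tri : ∀ j → 2 ℕ.* tri j ≡ j ℕ.* suc j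
twice-tri zero    = refl
twice-tri (suc j) = begin
  2 ℕ.* (suc j ℕ.+ tri j)               ≡⟨ ℕP.*-distribˡ-+ 2 (suc j) (tri j) ⟩
  2 ℕ.* suc j ℕ.+ 2 ℕ.* tri j           ≡⟨ cong (2 ℕ.* suc j ℕ.+_) (twice-tri j) ⟩
  2 ℕ.* suc j ℕ.+ j ℕ.* suc j           ≡⟨ ring j ⟩
  suc j ℕ.* suc (suc j)                 ∎
  where
  open ≡-Reasoning
  ring : ∀ j → 2 ℕ.* suc j ℕ.+ j ℕ.* suc j ≡ suc j ℕ.* suc (suc j)
  ring = solveℕ-∀

twice-pent⁺ : ∀ j → 2 ℕ.* pent⁺ j ≡ 3 ℕ.* suc j ℕ.* suc j ℕ.+ suc j
twice-pent⁺ j = begin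
  2 ℕ.* pent⁺ j                                        ≡⟨ ℕP.*-distribˡ-+ 2 (suc j ℕ.* suc j) (tri (suc j)) ⟩
  2 ℕ.* (suc j ℕ.* suc j) ℕ.+ 2 ℕ.* tri (suc j)        ≡⟨ cong (2 ℕ.* (suc j ℕ.* suc j) ℕ.+_) (twice-tri (suc j)) ⟩
  2 ℕ.* (suc j ℕ.* suc j) ℕ.+ suc j ℕ.* suc (suc j)    ≡⟨ ring j ⟩
  3 ℕ.* suc j ℕ.* suc j ℕ.+ suc j                      ∎
  where
  open ≡-Reasoning
  ring : ∀ j → 2 ℕ.* (suc j ℕ.* suc j) ℕ.+ suc j ℕ.* suc (suc j) ≡ 3 ℕ.* suc j ℕ.* suc j ℕ.+ suc j
  ring = solveℕ-∀

twice-pent⁻ : ∀ j → 2 ℕ.* pent⁻ j ≡ 3 ℕ.* suc j ℕ.* suc j ℕ.∸ suc j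
twice-pent⁻ j = begin
  2 ℕ.* pent⁻ j                                        ≡⟨ ℕP.m+n∸n≡m _ (suc j) ⟨
  2 ℕ.* pent⁻ j ℕ.+ suc j ℕ.∸ suc j                    ≡⟨ cong (ℕ._∸ suc j) (ring′ j) ⟩
  3 ℕ.* suc j ℕ.* suc j ℕ.∸ suc j                      ∎
  where
  open ≡-Reasoning
  ring : ∀ j → 2 ℕ.* (suc j ℕ.* suc j) ℕ.+ j ℕ.* suc j ℕ.+ suc j ≡ 3 ℕ.* suc j ℕ.* suc j
  ring = solveℕ-∀
  ring′ : ∀ j → 2 ℕ.* pent⁻ j ℕ.+ suc j ≡ 3 ℕ.* suc j ℕ.* suc j
  ring′ j = trans (cong (ℕ._+ suc j) (trans (ℕP.*-distribˡ-+ 2 (suc j ℕ.* suc j) (tri j))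
                                            (cong (2 ℕ.* (suc j ℕ.* suc j) ℕ.+_) (twice-tri j))))
                  (ring j)

isPent-hit : ∀ m j → pent⁻ j ≡ m ⊎ pent⁺ j ≡ m → isPent m (suc j) ≡ true
isPent-hit m j (inj₁ refl) =
  trans (cong (⌊ 2 ℕ.* m ≟ 3 ℕ.* suc j ℕ.* suc j ℕ.+ suc j ⌋ ∨_) (isYes-true _ (twice-pent⁻ j))) (∨-zeroʳ _)
isPent-hit m j (inj₂ refl) =
  cong (_∨ ⌊ 2 ℕ.* m ≟ 3 ℕ.* suc j ℕ.* suc j ℕ.∸ suc j ⌋) (isYes-true _ (twice-pent⁺ j))

isPent-miss : ∀ m j → ¬ (pent⁻ j ≡ m ⊎ pent⁺ j ≡ m) → isPent m (suc j) ≡ false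
isPent-miss m j miss = cong₂ _∨_
  (isYes-false (2 ℕ.* m ≟ 3 ℕ.* suc j ℕ.* suc j ℕ.+ suc j)
               (λ e → miss (inj₂ (ℕP.*-cancelˡ-≡ _ _ 2 (trans (twice-pent⁺ j) (sym e))))))
  (isYes-false (2 ℕ.* m ≟ 3 ℕ.* suc j ℕ.* suc j ℕ.∸ suc j)
               (λ e → miss (inj₁ (ℕP.*-cancelˡ-≡ _ _ 2 (trans (twice-pent⁻ j) (sym e))))))

sign≡−1^ : ∀ k → sign k ≡ −1^ k
sign≡−1^ zero          = refl
sign≡−1^ (suc zero)    = refl
sign≡−1^ (suc (suc k)) = begin
  sign (suc (suc k))  ≡⟨ cong (λ r → if ⌊ r ≟ 0 ⌋ then + 1 else - + 1) (trans (cong (_% 2) (ℕP.+-comm 2 k)) ([m+n]%n≡m%n k 2)) ⟩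
  sign k              ≡⟨ sign≡−1^ k ⟩
  −1^ k               ≡⟨ ℤP.neg-involutive (−1^ k) ⟨
  −1^ suc (suc k)     ∎
  where open ≡-Reasoning

pentSeries≡searchPent : ∀ N m → pentSeries N m ≡ searchPent m N
pentSeries≡searchPent zero    m = refl
pentSeries≡searchPent (suc j) m with (pent⁻ j ≟ m) ⊎-dec (pent⁺ j ≟ m)
... | yes hit = begin
  pentSeries j m + pentTerm j m    ≡⟨ cong₂ _+_ (pentSeries-before j (pent⁻≤m hit)) (pentTerm-hit j hit) ⟩
  + 0 + −1^ suc j                  ≡⟨ ℤP.+-identityˡ _ ⟩
  −1^ suc j                        ≡⟨ sign≡−1^ (suc j) ⟨
  sign (suc j)                     ≡⟨ cong (if_then sign (suc j) else searchPent m j) (isPent-hit m j hit) ⟨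
  searchPent m (suc j)             ∎
  where
  open ≡-Reasoning
  pent⁻≤m : pent⁻ j ≡ m ⊎ pent⁺ j ≡ m → pent⁻ j ≤ m
  pent⁻≤m (inj₁ refl) = ℕP.≤-refl
  pent⁻≤m (inj₂ refl) = ℕP.<⇒≤ (pent⁻<pent⁺ j)
... | no miss = begin
  pentSeries j m + pentTerm j m    ≡⟨ cong₂ _+_ (pentSeries≡searchPent j m) (pentTerm-miss j (miss ∘ inj₁) (miss ∘ inj₂)) ⟩
  searchPent m j + + 0             ≡⟨ ℤP.+-identityʳ _ ⟩
  searchPent m j                   ≡⟨ cong (if_then sign (suc j) else searchPent m j) (isPent-miss m j miss) ⟨
  searchPent m (suc j)             ∎
  where open ≡-Reasoning

ωℕ≡δ+pentSeries : ∀ m → ωℕ m ≡ δ m + pentSeries m m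
ωℕ≡δ+pentSeries zero    = refl
ωℕ≡δ+pentSeries (suc m) = trans (sym (pentSeries≡searchPent (suc m) (suc m))) (sym (ℤP.+-identityˡ _))

pentagonal-theorem : ∀ {n m} → m ≤ n → prodFrom 0 n m ≡ ωℕ m
pentagonal-theorem {n} {m} m≤n = begin
  prodFrom 0 n m           ≡⟨ shanks-low m≤n ⟨
  shanks n m               ≡⟨ shanks≡δ+pentSeries n m ⟩
  δ m + pentSeries n m     ≡⟨ cong (λ z → δ m + z) (pentSeries-stable m≤n) ⟩
  δ m + pentSeries m m     ≡⟨ ωℕ≡δ+pentSeries m ⟨
  ωℕ m                     ∎
  where open ≡-Reasoning

largest-part-fuel : ∀ b m → suc b ℕ.+ (m ℕ.∸ b) ≤ b ℕ.+ suc m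
largest-part-fuel b m = subst (suc b ℕ.+ (m ℕ.∸ b) ≤_) (sym (ℕP.+-suc b m)) (s≤s (ℕP.+-monoʳ-≤ b (ℕP.m∸n≤m m b)))

partsF-fuel : ∀ f f′ b m → b ℕ.+ m ≤ f → b ℕ.+ m ≤ f′ → partsF f b m ≡ partsF f′ b m
partsF-fuel f       f′       b       zero    _ _ = refl
partsF-fuel f       f′       zero    (suc m) _ _ = refl
partsF-fuel (suc f) (suc f′) (suc b) (suc m) (s≤s enough) (s≤s enough′) =
  cong₂ _++_ (partsF-fuel f f′ b (suc m) enough enough′)
             (cong (λ ps → if ⌊ suc b ≤? suc m ⌋ then map (suc b ∷_) ps else [])
                   (partsF-fuel f f′ (suc b) (m ℕ.∸ b) (ℕP.≤-trans (largest-part-fuel b m) enough)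
                                                       (ℕP.≤-trans (largest-part-fuel b m) enough′)))

partitionsB-largest : ∀ b m → suc b ≤ suc m →
  partitionsB (suc b) (suc m) ≡ partitionsB b (suc m) ++ map (suc b ∷_) (partitionsB (suc b) (m ℕ.∸ b))
partitionsB-largest b m b<m = cong (partitionsB b (suc m) ++_) (begin
  (if ⌊ suc b ≤? suc m ⌋ then map (suc b ∷_) rest else [])
    ≡⟨ cong (if_then map (suc b ∷_) rest else []) (isYes-true (suc b ≤? suc m) b<m) ⟩
  map (suc b ∷_) rest
    ≡⟨ cong (map (suc b ∷_)) (partsF-fuel _ _ (suc b) (m ℕ.∸ b) (largest-part-fuel b m) ℕP.≤-refl) ⟩
  map (suc b ∷_) (partitionsB (suc b) (m ℕ.∸ b))
    ∎)
  where
  open ≡-Reasoning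
  rest = partsF (b ℕ.+ suc m) (suc b) (m ℕ.∸ b)

partitionsB-small : ∀ b m → ¬ suc b ≤ suc m → partitionsB (suc b) (suc m) ≡ partitionsB b (suc m)
partitionsB-small b m b≮m =
  trans (cong (λ c → partitionsB b (suc m) ++ (if c then map (suc b ∷_) (partsF (b ℕ.+ suc m) (suc b) (m ℕ.∸ b)) else []))
              (isYes-false (suc b ≤? suc m) b≮m))
        (LP.++-identityʳ _)

partitionsB-stable : ∀ {b N} → N ≤ b → partitionsB (suc b) N ≡ partitionsB b N
partitionsB-stable {b} {zero}  _   = refl
partitionsB-stable {b} {suc m} N≤b = partitionsB-small b m (ℕP.<⇒≱ (s≤s N≤b))

partitionsB-saturated : ∀ {N b} → N ≤′ b → partitionsB b N ≡ partitions N
partitionsB-saturated ≤′-refl         = refl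
partitionsB-saturated (≤′-step N≤′b) =
  trans (partitionsB-stable (ℕP.≤′⇒≤ N≤′b)) (partitionsB-saturated N≤′b)

if-All : ∀ {P : List ℕ → Set} {Q : Set} (d : Dec Q) {xs} → (Q → All P xs) → All P (if ⌊ d ⌋ then xs else [])
if-All (yes q) all = all q
if-All (no _)  _   = []

partsF-sum : ∀ f b m → All (λ p → sum p ≡ m) (partsF f b m)
partsF-sum f       b       zero    = refl ∷ []
partsF-sum f       zero    (suc m) = []
partsF-sum zero    (suc b) (suc m) = []
partsF-sum (suc f) (suc b) (suc m) = AllP.++⁺ (partsF-sum f b (suc m)) (if-All (suc b ≤? suc m) λ b≤m →
  AllP.map⁺ (All.map (λ sum≡ → cong suc (trans (cong (b ℕ.+_) sum≡) (ℕP.m+[n∸m]≡n (ℕP.≤-pred b≤m))))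
                     (partsF-sum f (suc b) (m ℕ.∸ b))))

pB : ℕ → Seq
pB b m = + length (partitionsB b m)

pB-zero : pB 0 ≗ δ
pB-zero zero    = refl
pB-zero (suc m) = refl

pB-recurrence : ∀ b → [1-q^ suc b ]· pB (suc b) ≗ pB b
pB-recurrence b zero    = refl
pB-recurrence b (suc m) = by-largest-part (suc b ≤? suc m)
  where
  cancel : ∀ x y → x + y - y ≡ x
  cancel = solve-∀
  by-largest-part : Dec (suc b ≤ suc m) → ([1-q^ suc b ]· pB (suc b)) (suc m) ≡ pB b (suc m)
  by-largest-part (yes b<m) = begin
    pB (suc b) (suc m) - (q^ b · pB (suc b)) m
      ≡⟨ cong₂ _-_ (cong (+_ ∘ length) (partitionsB-largest b m b<m)) (q^-above b (pB (suc b)) m (ℕP.≤-pred b<m)) ⟩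
    + length (partitionsB b (suc m) ++ map (suc b ∷_) (partitionsB (suc b) (m ℕ.∸ b))) - pB (suc b) (m ℕ.∸ b)
      ≡⟨ cong (λ l → + l - pB (suc b) (m ℕ.∸ b))
              (trans (LP.length-++ (partitionsB b (suc m)))
                     (cong (length (partitionsB b (suc m)) ℕ.+_) (LP.length-map (suc b ∷_) (partitionsB (suc b) (m ℕ.∸ b))))) ⟩
    pB b (suc m) + pB (suc b) (m ℕ.∸ b) - pB (suc b) (m ℕ.∸ b)
      ≡⟨ cancel (pB b (suc m)) (pB (suc b) (m ℕ.∸ b)) ⟩
    pB b (suc m)
      ∎
    where open ≡-Reasoning
  by-largest-part (no b≮m) =
    trans (cong₂ _-_ (cong (+_ ∘ length) (partitionsB-small b m b≮m))
                     (q^-below b (pB (suc b)) m (ℕP.≤-pred (ℕP.≰⇒> b≮m))))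
          (ℤP.+-identityʳ _)

prodFrom0-⋆-pB : ∀ b → prodFrom 0 b ⋆ pB b ≗ δ
prodFrom0-⋆-pB zero    n = trans (δ-⋆ (pB 0) n) (pB-zero n)
prodFrom0-⋆-pB (suc b) n = begin
  (([1-q^ suc b ]· prodFrom 0 b) ⋆ pB (suc b)) n     ≡⟨ ⋆-[1-q^] (suc b) (prodFrom 0 b) (pB (suc b)) n ⟩
  (prodFrom 0 b ⋆ [1-q^ suc b ]· pB (suc b)) n       ≡⟨ ⋆-congʳ (prodFrom 0 b) (pB-recurrence b) n ⟩
  (prodFrom 0 b ⋆ pB b) n                            ≡⟨ prodFrom0-⋆-pB b n ⟩
  δ n                                                ∎
  where open ≡-Reasoning

euler-recurrence : ∀ n → Σ< (suc n) (λ N → ωℕ (n ℕ.∸ N) * + length (partitions N)) ≡ δ n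
euler-recurrence n = trans (Σ<-cong (suc n) λ N N≤n →
  cong₂ _*_ (sym (pentagonal-theorem (ℕP.m∸n≤m n N)))
            (cong (+_ ∘ length) (sym (partitionsB-saturated (ℕP.≤⇒≤′ (ℕP.≤-pred N≤n))))))
  (prodFrom0-⋆-pB n n)

gcdList∣sum : ∀ p → gcdList p ∣ sum p
gcdList∣sum []      = divides 1 refl
gcdList∣sum (x ∷ p) = ∣m∣n⇒∣m+n (gcd[m,n]∣m x (gcdList p)) (∣-trans (gcd[m,n]∣n x (gcdList p)) (gcdList∣sum p))

gcdList∣elems : ∀ p → All (gcdList p ∣_) p
gcdList∣elems []      = []
gcdList∣elems (x ∷ p) = gcd[m,n]∣m x (gcdList p) ∷ All.map (∣-trans (gcd[m,n]∣n x (gcdList p))) (gcdList∣elems p)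

gcdList-map-* : ∀ c p → gcdList (map (c ℕ.*_) p) ≡ c ℕ.* gcdList p
gcdList-map-* c []      = sym (ℕP.*-zeroʳ c)
gcdList-map-* c (x ∷ p) =
  trans (cong (gcd (c ℕ.* x)) (gcdList-map-* c p)) (sym (c*gcd[m,n]≡gcd[cm,cn] c x (gcdList p)))

module _ {X : Set} {P : Pred X 0ℓ} (P? : Decidable P) where

  length-filter-∷ : ∀ x xs → + length (filter P? (x ∷ xs)) ≡ 𝟙 (P? x) + + length (filter P? xs)
  length-filter-∷ x xs with P? x
  ... | yes _ = refl
  ... | no _  = sym (ℤP.+-identityˡ _)

  filter-⊆ : ∀ {R : Pred X 0ℓ} (R? : Decidable R) → (∀ {x} → P x → R x) →
             ∀ xs → filter P? (filter R? xs) ≡ filter P? xs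
  filter-⊆ R? P⊆R []       = refl
  filter-⊆ R? P⊆R (x ∷ xs) with R? x
  ... | yes _  = by-P (P? x)
    where
    by-P : Dec (P x) → filter P? (x ∷ filter R? xs) ≡ filter P? (x ∷ xs)
    by-P (yes px) = trans (LP.filter-accept P? px)
                          (trans (cong (x ∷_) (filter-⊆ R? P⊆R xs)) (sym (LP.filter-accept P? px)))
    by-P (no ¬px) = trans (LP.filter-reject P? ¬px) (trans (filter-⊆ R? P⊆R xs) (sym (LP.filter-reject P? ¬px)))
  ... | no ¬rx = trans (filter-⊆ R? P⊆R xs) (sym (LP.filter-reject P? (¬rx ∘ P⊆R)))

module _ {X Y : Set} {P : Pred Y 0ℓ} {R : Pred X 0ℓ} (P? : Decidable P) (R? : Decidable R) (f : X → Y) where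

  length-filter-map : (∀ {x} → P (f x) → R x) → (∀ {x} → R x → P (f x)) →
                      ∀ xs → length (filter P? (map f xs)) ≡ length (filter R? xs)
  length-filter-map to from []       = refl
  length-filter-map to from (x ∷ xs) with P? (f x) | R? x
  ... | yes _   | yes _  = cong suc (length-filter-map to from xs)
  ... | yes pfx | no ¬rx = ⊥-elim (¬rx (to pfx))
  ... | no ¬pfx | yes rx = ⊥-elim (¬pfx (from rx))
  ... | no _    | no _   = length-filter-map to from xs

length≡Σ<-length-filter : ∀ {X : Set} (g : X → ℕ) B xs → All (λ x → 1 ≤ g x × g x ≤ B) xs →
  + length xs ≡ Σ< B (λ d → + length (filter (λ x → g x ≟ suc d) xs))
length≡Σ<-length-filter g B [] _ = sym (Σ<-zero B (λ _ _ → refl))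
length≡Σ<-length-filter g B (x ∷ xs) ((1≤gx , gx≤B) ∷ bounded) = begin
  + 1 + + length xs
    ≡⟨ cong₂ _+_ (sym counted-once) (length≡Σ<-length-filter g B xs bounded) ⟩
  Σ< B (λ d → 𝟙 (g x ≟ suc d)) + Σ< B (λ d → + length (filter (λ x → g x ≟ suc d) xs))
    ≡⟨ Σ<-distrib-+ B _ _ ⟨
  Σ< B (λ d → 𝟙 (g x ≟ suc d) + + length (filter (λ x → g x ≟ suc d) xs))
    ≡⟨ Σ<-cong B (λ d _ → length-filter-∷ (λ x → g x ≟ suc d) x xs) ⟨
  Σ< B (λ d → + length (filter (λ x → g x ≟ suc d) (x ∷ xs)))
    ∎
  where
  open ≡-Reasoning
  k = ℕ.pred (g x)
  gx≡1+k : g x ≡ suc k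
  gx≡1+k = sym (ℕP.suc-pred (g x) {{ℕ.>-nonZero 1≤gx}})
  counted-once : Σ< B (λ d → 𝟙 (g x ≟ suc d)) ≡ + 1
  counted-once = trans
    (Σ<-cong B (λ d _ → trans (𝟙-cong (g x ≟ suc d) (k ≟ d) (ℕP.suc-injective ∘ trans (sym gx≡1+k)) (trans gx≡1+k ∘ cong suc))
                              (sym (ℤP.*-identityʳ _))))
    (Σ<-select B k (λ _ → + 1) (λ B≤k → ⊥-elim (ℕP.<⇒≱ (subst (_≤ B) gx≡1+k gx≤B) B≤k)))

pGcd : ℕ → ℕ → ℕ
pGcd d N = length (filter (λ p → gcdList p ≟ d) (partitions N))

length-partitions≡Σ<-pGcd : ∀ {N B} → 1 ≤ N → N ≤ B → + length (partitions N) ≡ Σ< B (λ d → + pGcd (suc d) N)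
length-partitions≡Σ<-pGcd {N} {B} 1≤N N≤B =
  length≡Σ<-length-filter gcdList B (partitions N) (All.map (λ {p} → gcd-bounds {p}) (partsF-sum (N ℕ.+ N) N N))
  where
  gcd-bounds : ∀ {p} → sum p ≡ N → 1 ≤ gcdList p × gcdList p ≤ B
  gcd-bounds {p} sum≡N with gcdList p | gcdList∣sum p
  ... | zero  | 0∣sum = ⊥-elim (ℕP.<⇒≢ 1≤N (sym (trans (sym sum≡N) (0∣⇒≡0 0∣sum))))
  ... | suc g | g∣sum = s≤s z≤n , ℕP.≤-trans (∣⇒≤ {{ℕ.>-nonZero 1≤N}} (subst (suc g ∣_) sum≡N g∣sum)) N≤B

pGcd-∤ : ∀ {d N} → ¬ d ∣ N → pGcd d N ≡ 0
pGcd-∤ {d} {N} d∤N = cong length (LP.filter-none (λ p → gcdList p ≟ d)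
  (All.map (λ {p} sum≡N gcd≡d → d∤N (subst₂ _∣_ gcd≡d sum≡N (gcdList∣sum p))) (partsF-sum (N ℕ.+ N) N N)))

module Scaling (e : ℕ) where

  D : ℕ
  D = suc e

  scale : List ℕ → List ℕ
  scale = map (D ℕ.*_)

  keepScaled : List (List ℕ) → List (List ℕ)
  keepScaled = filter (all? (D ∣?_))

  keepScaled-map-∷-∣ : ∀ {x} → D ∣ x → ∀ ps → keepScaled (map (x ∷_) ps) ≡ map (x ∷_) (keepScaled ps)
  keepScaled-map-∷-∣ D∣x []       = refl
  keepScaled-map-∷-∣ {x} D∣x (p ∷ ps) = by-head (all? (D ∣?_) p)
    where
    by-head : Dec (All (D ∣_) p) → keepScaled (map (x ∷_) (p ∷ ps)) ≡ map (x ∷_) (keepScaled (p ∷ ps))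
    by-head (yes all∣) =
      trans (LP.filter-accept (all? (D ∣?_)) {x ∷ p} {map (x ∷_) ps} (D∣x ∷ all∣))
            (trans (cong ((x ∷ p) ∷_) (keepScaled-map-∷-∣ D∣x ps))
                   (cong (map (x ∷_)) (sym (LP.filter-accept (all? (D ∣?_)) {p} {ps} all∣))))
    by-head (no ¬all∣) =
      trans (LP.filter-reject (all? (D ∣?_)) {x ∷ p} {map (x ∷_) ps} (¬all∣ ∘ All.tail))
            (trans (keepScaled-map-∷-∣ D∣x ps)
                   (cong (map (x ∷_)) (sym (LP.filter-reject (all? (D ∣?_)) {p} {ps} ¬all∣))))

  keepScaled-map-∷-∤ : ∀ {x} → ¬ D ∣ x → ∀ ps → keepScaled (map (x ∷_) ps) ≡ []
  keepScaled-map-∷-∤ {x} D∤x ps =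
    LP.filter-none (all? (D ∣?_)) {map (x ∷_) ps} (AllP.map⁺ (All.tabulate {xs = ps} (λ _ → D∤x ∘ All.head)))

  keepScaled-skip : ∀ {b} → ¬ D ∣ suc b → ∀ m → keepScaled (partitionsB (suc b) m) ≡ keepScaled (partitionsB b m)
  keepScaled-skip         D∤b+1 zero    = refl
  keepScaled-skip {b} D∤b+1 (suc m) = by-largest-part (suc b ≤? suc m)
    where
    by-largest-part : Dec (suc b ≤ suc m) → keepScaled (partitionsB (suc b) (suc m)) ≡ keepScaled (partitionsB b (suc m))
    by-largest-part (yes b<m) = begin
      keepScaled (partitionsB (suc b) (suc m))
        ≡⟨ cong keepScaled (partitionsB-largest b m b<m) ⟩
      keepScaled (partitionsB b (suc m) ++ map (suc b ∷_) (partitionsB (suc b) (m ℕ.∸ b)))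
        ≡⟨ LP.filter-++ (all? (D ∣?_)) (partitionsB b (suc m)) (map (suc b ∷_) (partitionsB (suc b) (m ℕ.∸ b))) ⟩
      keepScaled (partitionsB b (suc m)) ++ keepScaled (map (suc b ∷_) (partitionsB (suc b) (m ℕ.∸ b)))
        ≡⟨ cong (keepScaled (partitionsB b (suc m)) ++_) (keepScaled-map-∷-∤ D∤b+1 (partitionsB (suc b) (m ℕ.∸ b))) ⟩
      keepScaled (partitionsB b (suc m)) ++ []
        ≡⟨ LP.++-identityʳ _ ⟩
      keepScaled (partitionsB b (suc m))
        ∎
      where open ≡-Reasoning
    by-largest-part (no b≮m) = cong keepScaled (partitionsB-small b m b≮m)

  keepScaled-round-down : ∀ c r m → r < D → keepScaled (partitionsB (D ℕ.* c ℕ.+ r) m) ≡ keepScaled (partitionsB (D ℕ.* c) m)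
  keepScaled-round-down c zero    m _   = cong (λ b → keepScaled (partitionsB b m)) (ℕP.+-identityʳ _)
  keepScaled-round-down c (suc r) m r<D = begin
    keepScaled (partitionsB (D ℕ.* c ℕ.+ suc r) m)    ≡⟨ cong (λ b → keepScaled (partitionsB b m)) (ℕP.+-suc (D ℕ.* c) r) ⟩
    keepScaled (partitionsB (suc (D ℕ.* c ℕ.+ r)) m)  ≡⟨ keepScaled-skip D∤ m ⟩
    keepScaled (partitionsB (D ℕ.* c ℕ.+ r) m)        ≡⟨ keepScaled-round-down c r m (ℕP.<-trans (ℕP.n<1+n r) r<D) ⟩
    keepScaled (partitionsB (D ℕ.* c) m)              ∎
    where
    open ≡-Reasoning
    D∤ : ¬ D ∣ suc (D ℕ.* c ℕ.+ r)
    D∤ D∣ = ℕP.<⇒≱ r<D (∣⇒≤ (∣m+n∣m⇒∣n (subst (D ∣_) (sym (ℕP.+-suc (D ℕ.* c) r)) D∣) (m∣m*n c)))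

  D*suc : ∀ x → D ℕ.* suc x ≡ suc (D ℕ.* x ℕ.+ e)
  D*suc x = ring e x
    where
    ring : ∀ e x → suc e ℕ.* suc x ≡ suc (suc e ℕ.* x ℕ.+ e)
    ring = solveℕ-∀

  -- The fuel k ≥ c + M makes the recursion structural: it recurses at (c, M + 1) and at (c + 1, M − c).
  keepScaled-partitionsB : ∀ k c M → c ℕ.+ M ≤ k → keepScaled (partitionsB (D ℕ.* c) (D ℕ.* M)) ≡ map scale (partitionsB c M)
  keepScaled-partitionsB k       c       zero    _ = cong (λ m → keepScaled (partitionsB (D ℕ.* c) m)) (ℕP.*-zeroʳ D)
  keepScaled-partitionsB k       zero    (suc M) _ = cong (λ b → keepScaled (partitionsB b (D ℕ.* suc M))) (ℕP.*-zeroʳ D)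
  keepScaled-partitionsB (suc k) (suc c) (suc M) (s≤s c+M<k) = begin
    keepScaled (partitionsB (D ℕ.* suc c) (D ℕ.* suc M))   ≡⟨ cong₂ (λ b m → keepScaled (partitionsB b m)) (D*suc c) (D*suc M) ⟩
    keepScaled (partitionsB (suc b) (suc m))               ≡⟨ by-largest-part (suc c ≤? suc M) ⟩
    map scale (partitionsB (suc c) (suc M))                ∎
    where
    open ≡-Reasoning
    b = D ℕ.* c ℕ.+ e
    m = D ℕ.* M ℕ.+ e

    smaller-parts : keepScaled (partitionsB b (suc m)) ≡ map scale (partitionsB c (suc M))
    smaller-parts = begin
      keepScaled (partitionsB b (suc m))                 ≡⟨ cong (λ m → keepScaled (partitionsB b m)) (D*suc M) ⟨
      keepScaled (partitionsB b (D ℕ.* suc M))           ≡⟨ keepScaled-round-down c e (D ℕ.* suc M) ℕP.≤-refl ⟩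
      keepScaled (partitionsB (D ℕ.* c) (D ℕ.* suc M))   ≡⟨ keepScaled-partitionsB k c (suc M) c+M<k ⟩
      map scale (partitionsB c (suc M))                  ∎

    largest-part : c ≤ M → keepScaled (map (suc b ∷_) (partitionsB (suc b) (m ℕ.∸ b)))
                           ≡ map scale (map (suc c ∷_) (partitionsB (suc c) (M ℕ.∸ c)))
    largest-part c≤M = begin
      keepScaled (map (suc b ∷_) (partitionsB (suc b) (m ℕ.∸ b)))
        ≡⟨ keepScaled-map-∷-∣ (subst (D ∣_) (D*suc c) (m∣m*n (suc c))) (partitionsB (suc b) (m ℕ.∸ b)) ⟩
      map (suc b ∷_) (keepScaled (partitionsB (suc b) (m ℕ.∸ b)))
        ≡⟨ cong₂ (λ x m′ → map (x ∷_) (keepScaled (partitionsB x m′))) (D*suc c) (sym m∸b≡D*[M∸c]) ⟨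
      map (D ℕ.* suc c ∷_) (keepScaled (partitionsB (D ℕ.* suc c) (D ℕ.* (M ℕ.∸ c))))
        ≡⟨ cong (map (D ℕ.* suc c ∷_)) (keepScaled-partitionsB k (suc c) (M ℕ.∸ c) remainder-fuel) ⟩
      map (D ℕ.* suc c ∷_) (map scale (partitionsB (suc c) (M ℕ.∸ c)))
        ≡⟨ LP.map-∘ (partitionsB (suc c) (M ℕ.∸ c)) ⟨
      map (scale ∘ (suc c ∷_)) (partitionsB (suc c) (M ℕ.∸ c))
        ≡⟨ LP.map-∘ (partitionsB (suc c) (M ℕ.∸ c)) ⟩
      map scale (map (suc c ∷_) (partitionsB (suc c) (M ℕ.∸ c)))
        ∎
      where
      m∸b≡D*[M∸c] : m ℕ.∸ b ≡ D ℕ.* (M ℕ.∸ c)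
      m∸b≡D*[M∸c] = begin
        D ℕ.* M ℕ.+ e ℕ.∸ (D ℕ.* c ℕ.+ e)   ≡⟨ cong₂ ℕ._∸_ (ℕP.+-comm (D ℕ.* M) e) (ℕP.+-comm (D ℕ.* c) e) ⟩
        e ℕ.+ D ℕ.* M ℕ.∸ (e ℕ.+ D ℕ.* c)   ≡⟨ ℕP.[m+n]∸[m+o]≡n∸o e (D ℕ.* M) (D ℕ.* c) ⟩
        D ℕ.* M ℕ.∸ D ℕ.* c                 ≡⟨ ℕP.*-distribˡ-∸ D M c ⟨
        D ℕ.* (M ℕ.∸ c)                     ∎
      remainder-fuel : suc c ℕ.+ (M ℕ.∸ c) ≤ k
      remainder-fuel = ℕP.≤-trans (s≤s (ℕP.+-monoʳ-≤ c (ℕP.m∸n≤m M c))) (subst (_≤ k) (ℕP.+-suc c M) c+M<k)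

    by-largest-part : Dec (suc c ≤ suc M) → keepScaled (partitionsB (suc b) (suc m)) ≡ map scale (partitionsB (suc c) (suc M))
    by-largest-part (yes c≤M) = begin
      keepScaled (partitionsB (suc b) (suc m))
        ≡⟨ cong keepScaled (partitionsB-largest b m b≤m) ⟩
      keepScaled (partitionsB b (suc m) ++ map (suc b ∷_) (partitionsB (suc b) (m ℕ.∸ b)))
        ≡⟨ LP.filter-++ (all? (D ∣?_)) (partitionsB b (suc m)) (map (suc b ∷_) (partitionsB (suc b) (m ℕ.∸ b))) ⟩
      keepScaled (partitionsB b (suc m)) ++ keepScaled (map (suc b ∷_) (partitionsB (suc b) (m ℕ.∸ b)))
        ≡⟨ cong₂ _++_ smaller-parts (largest-part (ℕP.≤-pred c≤M)) ⟩
      map scale (partitionsB c (suc M)) ++ map scale (map (suc c ∷_) (partitionsB (suc c) (M ℕ.∸ c)))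
        ≡⟨ LP.map-++ scale (partitionsB c (suc M)) _ ⟨
      map scale (partitionsB c (suc M) ++ map (suc c ∷_) (partitionsB (suc c) (M ℕ.∸ c)))
        ≡⟨ cong (map scale) (partitionsB-largest c M c≤M) ⟨
      map scale (partitionsB (suc c) (suc M))
        ∎
      where
      b≤m : suc b ≤ suc m
      b≤m = subst₂ _≤_ (D*suc c) (D*suc M) (ℕP.*-monoʳ-≤ D c≤M)
    by-largest-part (no c≰M) = begin
      keepScaled (partitionsB (suc b) (suc m))   ≡⟨ cong keepScaled (partitionsB-small b m b≰m) ⟩
      keepScaled (partitionsB b (suc m))         ≡⟨ smaller-parts ⟩
      map scale (partitionsB c (suc M))          ≡⟨ cong (map scale) (partitionsB-small c M c≰M) ⟨
      map scale (partitionsB (suc c) (suc M))    ∎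
      where
      b≰m : ¬ suc b ≤ suc m
      b≰m b≤m = c≰M (ℕP.*-cancelˡ-≤ D (subst₂ _≤_ (sym (D*suc c)) (sym (D*suc M)) b≤m))

  pGcd-scale : ∀ M → pGcd D (D ℕ.* M) ≡ pψ M
  pGcd-scale M = begin
    length (filter gcd≟D (partitions (D ℕ.* M)))
      ≡⟨ cong length (filter-⊆ gcd≟D (all? (D ∣?_)) (λ {p} gcd≡D → subst (λ g → All (g ∣_) p) gcd≡D (gcdList∣elems p))
                                (partitions (D ℕ.* M))) ⟨
    length (filter gcd≟D (keepScaled (partitions (D ℕ.* M))))
      ≡⟨ cong (length ∘ filter gcd≟D) (keepScaled-partitionsB (M ℕ.+ M) M M ℕP.≤-refl) ⟩
    length (filter gcd≟D (map scale (partitions M)))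
      ≡⟨ length-filter-map gcd≟D (λ p → gcdList p ≟ 1) scale
           (λ {p} gcd≡D → ℕP.*-cancelˡ-≡ _ _ D (trans (sym (gcdList-map-* D p)) (trans gcd≡D (sym (ℕP.*-identityʳ D)))))
           (λ {p} gcd≡1 → trans (gcdList-map-* D p) (trans (cong (D ℕ.*_) gcd≡1) (ℕP.*-identityʳ D)))
           (partitions M) ⟩
    pψ M
      ∎
    where
    open ≡-Reasoning
    gcd≟D : Decidable (λ p → gcdList p ≡ D)
    gcd≟D p = gcdList p ≟ D

-- i + d (i + 1) ≡ N says (d + 1)(i + 1) = N + 1.
pGcd-as-Σ< : ∀ {n} d N → suc N ≤ n → + pGcd (suc d) (suc N) ≡ Σ< n (λ i → 𝟙 (i ℕ.+ d ℕ.* suc i ≟ N) * + pψ (suc i))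
pGcd-as-Σ< {n} d N N<n with suc d ∣? suc N
... | yes (divides (suc i₀) N+1≡i₀+1*d+1) = begin
  + pGcd (suc d) (suc N)                              ≡⟨ cong (+_ ∘ pGcd (suc d)) N+1≡d+1*i₀+1 ⟩
  + pGcd (suc d) (suc d ℕ.* suc i₀)                   ≡⟨ cong +_ (Scaling.pGcd-scale d (suc i₀)) ⟩
  + pψ (suc i₀)
    ≡⟨ Σ<-select n i₀ (λ i → + pψ (suc i)) (λ n≤i₀ → ⊥-elim (ℕP.<⇒≱ i₀<n n≤i₀)) ⟨
  Σ< n (λ i → 𝟙 (i₀ ≟ i) * + pψ (suc i))
    ≡⟨ Σ<-cong n (λ i _ → cong (_* + pψ (suc i)) (𝟙-cong (i₀ ≟ i) (i ℕ.+ d ℕ.* suc i ≟ N) to from)) ⟩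
  Σ< n (λ i → 𝟙 (i ℕ.+ d ℕ.* suc i ≟ N) * + pψ (suc i)) ∎
  where
  open ≡-Reasoning
  N+1≡d+1*i₀+1 : suc N ≡ suc d ℕ.* suc i₀
  N+1≡d+1*i₀+1 = trans N+1≡i₀+1*d+1 (ℕP.*-comm (suc i₀) (suc d))
  i₀<n : i₀ < n
  i₀<n = ℕP.≤-trans (ℕP.≤-trans (ℕP.m≤m*n (suc i₀) (suc d)) (ℕP.≤-reflexive (sym N+1≡i₀+1*d+1))) N<n
  to : ∀ {i} → i₀ ≡ i → i ℕ.+ d ℕ.* suc i ≡ N
  to refl = ℕP.suc-injective (sym N+1≡d+1*i₀+1)
  from : ∀ {i} → i ℕ.+ d ℕ.* suc i ≡ N → i₀ ≡ i
  from e = ℕP.suc-injective (ℕP.*-cancelˡ-≡ _ _ (suc d) (trans (sym N+1≡d+1*i₀+1) (sym (cong suc e))))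
... | no d+1∤N+1 = begin
  + pGcd (suc d) (suc N)                                ≡⟨ cong +_ (pGcd-∤ d+1∤N+1) ⟩
  + 0                                                   ≡⟨ Σ<-zero n (λ i _ → no-multiple i) ⟨
  Σ< n (λ i → 𝟙 (i ℕ.+ d ℕ.* suc i ≟ N) * + pψ (suc i)) ∎
  where
  open ≡-Reasoning
  no-multiple : ∀ i → 𝟙 (i ℕ.+ d ℕ.* suc i ≟ N) * + pψ (suc i) ≡ + 0
  no-multiple i = 𝟙-≢-* (λ e → d+1∤N+1 (divides (suc i) (trans (sym (cong suc e)) (ℕP.*-comm (suc d) (suc i))))) _

Σ<-fibres : ∀ n (κ : ℕ → ℕ → ℕ) (w a : ℕ → ℤ) → (∀ x → n ≤ x → w x ≡ + 0) →
  Σ< n (λ N → w N * Σ< n (λ d → Σ< n (λ i → 𝟙 (κ d i ≟ N) * a i)))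
  ≡ Σ< n (λ i → a i * Σ< n (λ d → w (κ d i)))
Σ<-fibres n κ w a w-vanishes = begin
  Σ< n (λ N → w N * Σ< n (λ d → Σ< n (λ i → 𝟙 (κ d i ≟ N) * a i)))
    ≡⟨ Σ<-cong n (λ N _ → distribute N) ⟩
  Σ< n (λ N → Σ< n (λ d → Σ< n (λ i → 𝟙 (κ d i ≟ N) * (a i * w N))))
    ≡⟨ Σ<-swap n n _ ⟩
  Σ< n (λ d → Σ< n (λ N → Σ< n (λ i → 𝟙 (κ d i ≟ N) * (a i * w N))))
    ≡⟨ Σ<-cong n (λ d _ → Σ<-swap n n _) ⟩
  Σ< n (λ d → Σ< n (λ i → Σ< n (λ N → 𝟙 (κ d i ≟ N) * (a i * w N))))
    ≡⟨ Σ<-cong n (λ d _ → Σ<-cong n (λ i _ → Σ<-select n (κ d i) (λ N → a i * w N) (vanish d i))) ⟩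
  Σ< n (λ d → Σ< n (λ i → a i * w (κ d i)))
    ≡⟨ Σ<-swap n n _ ⟩
  Σ< n (λ i → Σ< n (λ d → a i * w (κ d i)))
    ≡⟨ Σ<-cong n (λ i _ → Σ<-distribˡ-* n (a i) _) ⟩
  Σ< n (λ i → a i * Σ< n (λ d → w (κ d i)))
    ∎
  where
  open ≡-Reasoning
  rearrange : ∀ w s a → w * (s * a) ≡ s * (a * w)
  rearrange = solve-∀
  distribute : ∀ N → w N * Σ< n (λ d → Σ< n (λ i → 𝟙 (κ d i ≟ N) * a i))
                     ≡ Σ< n (λ d → Σ< n (λ i → 𝟙 (κ d i ≟ N) * (a i * w N)))
  distribute N = trans (sym (Σ<-distribˡ-* n (w N) _)) (Σ<-cong n (λ d _ →
    trans (sym (Σ<-distribˡ-* n (w N) _)) (Σ<-cong n (λ i _ → rearrange (w N) (𝟙 (κ d i ≟ N)) (a i)))))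
  vanish : ∀ d i → n ≤ κ d i → a i * w (κ d i) ≡ + 0
  vanish d i n≤κ = trans (cong (a i *_) (w-vanishes (κ d i) n≤κ)) (ℤP.*-zeroʳ (a i))

ω-diff-low : ∀ {n x} → x ≤ n → ω (+ n - + x) ≡ ωℕ (n ℕ.∸ x)
ω-diff-low {n} {x} x≤n = cong ω (trans (ℤP.m-n≡m⊖n n x) (ℤP.⊖-≥ x≤n))

ω-diff-high : ∀ {n x} → n < x → ω (+ n - + x) ≡ + 0
ω-diff-high {n} {x} n<x =
  trans (cong ω (trans (ℤP.m-n≡m⊖n n x) (ℤP.⊖-< n<x))) (ω-negative (ℕP.m<n⇒0<n∸m n<x))
  where
  ω-negative : ∀ {k} → 0 < k → ω (- + k) ≡ + 0
  ω-negative {suc k} _ = refl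

-ω≡Σ<-partitions : ∀ {n} → 1 ≤ n → - ωℕ n ≡ Σ< n (λ N → ω (+ n - + suc N) * + length (partitions (suc N)))
-ω≡Σ<-partitions {suc n′} _ = begin
  - ωℕ n                                                       ≡⟨ inverseʳ-unique (ωℕ n) _ no-constant-term ⟨
  Σ< n (λ N → ωℕ (n ℕ.∸ suc N) * + length (partitions (suc N)))
    ≡⟨ Σ<-cong n (λ N N<n → cong (_* + length (partitions (suc N))) (sym (ω-diff-low N<n))) ⟩
  Σ< n (λ N → ω (+ n - + suc N) * + length (partitions (suc N))) ∎
  where
  open ≡-Reasoning
  n = suc n′
  no-constant-term : ωℕ n + Σ< n (λ N → ωℕ (n ℕ.∸ suc N) * + length (partitions (suc N))) ≡ + 0
  no-constant-term = begin
    ωℕ n + Σ< n (λ N → ωℕ (n ℕ.∸ suc N) * + length (partitions (suc N)))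
      ≡⟨ cong (_+ Σ< n (λ N → ωℕ (n ℕ.∸ suc N) * + length (partitions (suc N)))) (ℤP.*-identityʳ (ωℕ n)) ⟨
    ωℕ n * + 1 + Σ< n (λ N → ωℕ (n ℕ.∸ suc N) * + length (partitions (suc N)))
      ≡⟨ Σ<-suc n _ ⟨
    Σ< (suc n) (λ N → ωℕ (n ℕ.∸ N) * + length (partitions N))
      ≡⟨ euler-recurrence n ⟩
    + 0 ∎

innerSum-as-Σ< : ∀ {n i} → i < n → innerSum (suc i) (n ℕ.∸ suc i) ≡ Σ< n (λ d → ω (+ n - + (suc d ℕ.* suc i)))
innerSum-as-Σ< {n} {i} i<n =
  trans (Σ<-cong (suc k) (λ j _ → cong ω (shift j)))
        (Σ<-extend (λ d → ω (+ n - + (suc d ℕ.* suc i))) k<n beyond)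
  where
  k = n ℕ.∸ suc i
  k<n : suc k ≤ n
  k<n = subst (_≤ n) (ℕP.+-∸-assoc 1 i<n) (ℕP.m∸n≤m n i)
  reassociate : ∀ x a b → x - a - b ≡ x - (a + b)
  reassociate = solve-∀
  shift : ∀ j → + k - + (j ℕ.* suc i) ≡ + n - + (suc j ℕ.* suc i)
  shift j = trans (cong (_- + (j ℕ.* suc i)) (sym (trans (ℤP.m-n≡m⊖n n (suc i)) (ℤP.⊖-≥ i<n))))
                  (reassociate (+ n) (+ suc i) (+ (j ℕ.* suc i)))
  beyond : ∀ d → suc k ≤ d → d < n → ω (+ n - + (suc d ℕ.* suc i)) ≡ + 0
  beyond d k<d _ = ω-diff-high (subst (_< suc d ℕ.* suc i) (ℕP.m+[n∸m]≡n i<n)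
                                      (ℕP.+-monoʳ-< (suc i) (ℕP.<-≤-trans k<d (ℕP.m≤m*n d (suc i)))))

mainTheorem12 : (n : ℕ) → n ≥ 1 → - ω (+ n) ≡ rhs n
mainTheorem12 n n≥1 = begin
  - ω (+ n)
    ≡⟨ -ω≡Σ<-partitions n≥1 ⟩
  Σ< n (λ N → w N * + length (partitions (suc N)))
    ≡⟨ Σ<-cong n (λ N N<n → cong (w N *_) (trans (length-partitions≡Σ<-pGcd (s≤s z≤n) N<n)
                                                 (Σ<-cong n (λ d _ → pGcd-as-Σ< d N N<n)))) ⟩
  Σ< n (λ N → w N * Σ< n (λ d → Σ< n (λ i → 𝟙 (i ℕ.+ d ℕ.* suc i ≟ N) * + pψ (suc i))))
    ≡⟨ Σ<-fibres n (λ d i → i ℕ.+ d ℕ.* suc i) w (λ i → + pψ (suc i)) (λ x n≤x → ω-diff-high (s≤s n≤x)) ⟩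
  Σ< n (λ i → + pψ (suc i) * Σ< n (λ d → ω (+ n - + (suc d ℕ.* suc i))))
    ≡⟨ Σ<-cong n (λ i i<n → cong (+ pψ (suc i) *_) (sym (innerSum-as-Σ< i<n))) ⟩
  rhs n
    ∎
  where
  open ≡-Reasoning
  w : ℕ → ℤ
  w N = ω (+ n - + suc N)
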